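{- For every $n\ge 8$, the graph $G(3,n)$ contains an induced cycle of length $6$.
   Context: For a prime $p$ and $n\in\mathbb{N}$, $G(p,n)$ is the simple graph with vertex set $\{2,4,\ldots,2n\}$ in which two distinct vertices $a,b$ are adjacent if and only if both $\frac{a+b}{2}$ and $\frac{|a-b|}{2}$ are odd positive integers neither of which equals $pk$ for an integer $k\ge 2$. -}

module Defs where

open import Data.Nat using (ℕ; zero; suc; _+_; _*_; _≤_; _<_; ∣_-_∣)
open import Data.Nat.DivMod using (_/_; _%_)
open import Data.Nat.Primality using (Prime)
open import Data.Fin using (Fin; toℕ)
open import Data.Product using (Σ; _×_; ∃)
open import Data.Sum using (_⊎_)
open import Relation.Binary.PropositionalEquality using (_≡_; _≢_)
open import Relation.Nullary using (¬_)
open import Function.Bundles using (_⇔_)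

Odd : ℕ → Set
Odd m = m % 2 ≡ 1

Allowed : ℕ → ℕ → Set
Allowed p m = Odd m × 0 < m × (∀ k → 2 ≤ k → m ≢ p * k)

IsVertex : ℕ → ℕ → Set
IsVertex n v = Σ ℕ (λ i → 1 ≤ i × i ≤ n × v ≡ 2 * i)

Adj : ℕ → ℕ → ℕ → Set
Adj p a b = a ≢ b × Allowed p ((a + b) / 2) × Allowed p (∣ a - b ∣ / 2)

CycAdj6 : Fin 6 → Fin 6 → Set
CycAdj6 i j = ((toℕ i + 1) % 6 ≡ toℕ j) ⊎ ((toℕ j + 1) % 6 ≡ toℕ i)

HasInducedC6 : ℕ → ℕ → Set
HasInducedC6 p n =
  Σ (Fin 6 → ℕ) λ v →
    (∀ i → IsVertex n (v i)) ×
    (∀ i j → v i ≡ v j → i ≡ j) ×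
    (∀ i j → Adj p (v i) (v j) ⇔ CycAdj6 i j)

{-# OPTIONS --safe #-}
module Submission where

-- The vertices 2, 8, 6, 16, 10, 12, taken in this cyclic order, alternate
-- between 2 and 0 modulo 4, so two vertices of the same class have an even
-- half-sum and are never adjacent. Of the nine cross pairs the six
-- consecutive ones have half-sums and half-differences in
-- {1, 3, 5, 7, 11, 13}, all allowed for p = 3, while each of the three
-- opposite pairs (2,16), (8,10), (6,12) has half-sum 9 = 3 * 3.
-- Since 16 = 2 * 8, these are vertices of G(3,n) for every n ≥ 8, and the
-- finitely many conditions are verified by evaluating decision procedures.

open import Defs
import Data.Bool.Properties as Bool
open import Data.Nat using (ℕ; zero; suc; _+_; _*_; _%_; _≤_; _<_; s≤s; s≤s⁻¹; _≟_; _≤?_; _<?_)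
open import Data.Nat.Properties using (≤-trans; m≤n*m; allUpTo?; anyUpTo?)
open import Data.Fin using (Fin; toℕ)
import Data.Fin as Fin
open import Data.Fin.Properties using (all?)
open import Data.Vec using ([]; _∷_; lookup)
open import Data.Product using (_,_; proj₁; proj₂)
open import Function using (_∘_; const)
open import Function.Bundles using (_⇔_; mk⇔)
open import Relation.Binary.PropositionalEquality using (_≡_; _≢_; refl)
open import Relation.Nullary using (Dec; yes; no; does; ¬?; contradiction)
open import Relation.Nullary.Decidable using (map′; _×-dec_; _⊎-dec_; _→-dec_; from-yes)

does-≡⇒⇔ : ∀ {a b} {A : Set a} {B : Set b} (A? : Dec A) (B? : Dec B) →
           does A? ≡ does B? → A ⇔ B
does-≡⇒⇔ (yes a) (yes b) _ = mk⇔ (const b) (const a)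
does-≡⇒⇔ (no ¬a) (no ¬b) _ = mk⇔ (λ a → contradiction a ¬a) (λ b → contradiction b ¬b)

multiple-factor-≤ : ∀ p k {m} → 0 < m → m ≡ p * k → k ≤ m
multiple-factor-≤ zero    k     ()  refl
multiple-factor-≤ (suc p) k 0<m refl = m≤n*m k (suc p)

noProperMultiple? : ∀ p {m} → 0 < m → Dec (∀ k → 2 ≤ k → m ≢ p * k)
noProperMultiple? p {m} 0<m =
  map′ unbounded (λ h {k} _ → h k)
       (allUpTo? (λ k → (2 ≤? k) →-dec ¬? (m ≟ p * k)) (suc m))
  where
  unbounded : (∀ {k} → k < suc m → 2 ≤ k → m ≢ p * k) → ∀ k → 2 ≤ k → m ≢ p * k
  unbounded h k 2≤k m≡pk = h (s≤s (multiple-factor-≤ p k 0<m m≡pk)) 2≤k m≡pk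

allowed? : ∀ p m → Dec (Allowed p m)
allowed? p m with 0 <? m
... | no  m≯0 = no (m≯0 ∘ proj₁ ∘ proj₂)
... | yes 0<m = (m % 2 ≟ 1) ×-dec (yes 0<m ×-dec noProperMultiple? p 0<m)

adj? : ∀ p a b → Dec (Adj p a b)
adj? p a b = ¬? (a ≟ b) ×-dec (allowed? p _ ×-dec allowed? p _)

cycAdj6? : ∀ i j → Dec (CycAdj6 i j)
cycAdj6? i j = ((toℕ i + 1) % 6 ≟ toℕ j) ⊎-dec ((toℕ j + 1) % 6 ≟ toℕ i)

isVertex? : ∀ n v → Dec (IsVertex n v)
isVertex? n v =
  map′ (λ (i , i≤n , 1≤i , v≡2i) → i , 1≤i , s≤s⁻¹ i≤n , v≡2i)
       (λ (i , 1≤i , i≤n , v≡2i) → i , s≤s i≤n , 1≤i , v≡2i)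
       (anyUpTo? (λ i → (1 ≤? i) ×-dec (v ≟ 2 * i)) (suc n))

isVertex-mono : ∀ {m n v} → m ≤ n → IsVertex m v → IsVertex n v
isVertex-mono m≤n (i , 1≤i , i≤m , v≡2i) = i , 1≤i , ≤-trans i≤m m≤n , v≡2i

hexagon : Fin 6 → ℕ
hexagon = lookup (2 ∷ 8 ∷ 6 ∷ 16 ∷ 10 ∷ 12 ∷ [])

hexagon-isVertex : ∀ i → IsVertex 8 (hexagon i)
hexagon-isVertex = from-yes (all? λ i → isVertex? 8 (hexagon i))

hexagon-injective : ∀ i j → hexagon i ≡ hexagon j → i ≡ j
hexagon-injective = from-yes (all? λ i → all? λ j → (hexagon i ≟ hexagon j) →-dec (i Fin.≟ j))

hexagon-adj≡cycAdj6 : ∀ i j → does (adj? 3 (hexagon i) (hexagon j)) ≡ does (cycAdj6? i j)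
hexagon-adj≡cycAdj6 =
  from-yes (all? λ i → all? λ j → does (adj? 3 (hexagon i) (hexagon j)) Bool.≟ does (cycAdj6? i j))

lemma4p4 : (n : ℕ) → 8 ≤ n → HasInducedC6 3 n
lemma4p4 n 8≤n =
  hexagon ,
  (λ i → isVertex-mono 8≤n (hexagon-isVertex i)) ,
  hexagon-injective ,
  (λ i j → does-≡⇒⇔ (adj? 3 (hexagon i) (hexagon j)) (cycAdj6? i j) (hexagon-adj≡cycAdj6 i j))
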